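{- For every integer $n\ge 2$, ${\rm sat}^*(n,\mathbb{B}_3)\le 3n-2$.
   Context: $\mathbb{B}_3$ is the Boolean lattice $2^{[3]}$ ordered by inclusion. For a poset $P=(P,\leqslant)$, a family $\mathcal{G}$ of sets is a (induced) copy of $P$ if there is a bijection $b:P\to\mathcal{G}$ such that $p\leqslant q$ if and only if $b(p)\subseteq b(q)$. A family $\mathcal{F}\subseteq 2^{[n]}$ is induced $P$-saturated if $\mathcal{F}$ contains no copy of $P$, but for every $G\in 2^{[n]}\setminus\mathcal{F}$ the family $\mathcal{F}\cup\{G\}$ contains a copy of $P$. ${\rm sat}^*(n,P)$ is the minimum size of an induced $P$-saturated family $\mathcal{F}\subseteq 2^{[n]}$. -}

module Defs where

open import Data.Nat using (ℕ; _∸_; _*_)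
open import Data.Product using (Σ; _×_)
open import Data.List using (List; _∷_; length)
open import Data.List.Membership.Propositional using (_∈_; _∉_)
open import Data.Fin.Subset using (Subset; _⊆_)
open import Function.Bundles using (_⇔_)
open import Function.Definitions using (Injective)
open import Relation.Binary.PropositionalEquality using (_≡_)
open import Relation.Nullary using (¬_)

-- A family of subsets of [n] = {0,…,n-1} is a list of subsets
-- (Subset n = Vec Bool n).  Its size is the length of the list
-- (the statement additionally requires no repetitions).
Family : ℕ → Set
Family n = List (Subset n)

B₃ : Set
B₃ = Subset 3

CopyOfB₃ : ∀ {n} → Family n → Set
CopyOfB₃ {n} F =
  Σ (B₃ → Subset n) λ b →
    (∀ p → b p ∈ F) ×
    Injective _≡_ _≡_ b ×
    (∀ p q → (p ⊆ q) ⇔ (b p ⊆ b q))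

InducedB₃Saturated : ∀ {n} → Family n → Set
InducedB₃Saturated {n} F =
  ¬ CopyOfB₃ F ×
  (∀ (G : Subset n) → G ∉ F → CopyOfB₃ (G ∷ F))

-- The family is [n] together with the partial transversals of the blocks {0, 1} and {2, …, n−1}
-- (the sets meeting each block in at most one point): 1 + 3(n − 1) = 3n − 2 sets.  Apart from [n]
-- its members have at most two points, lying in different blocks.  In a copy of 𝔹₃ the images of
-- ∅ ⊂ atom ⊂ coatom ⊂ [3] have strictly growing sizes, so the atoms go to singletons {x₀}, {x₁}, {x₂}
-- and each coatom to a member containing two of these points, which must then lie in different
-- blocks: three points pairwise in different blocks, but there are only two blocks.
-- A set G outside the family either contains 0 and 1 and misses some y ≥ 2, or contains two points
-- of {2, …, n−1} and misses 0 or 1.  Either way two points a, c ∈ G and a point b ∉ G of the other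
-- block give a copy of 𝔹₃: ∅, {a}, {b}, {c}, {a, b}, {b, c}, G, [n].

module Submission where

open import Defs
open import Data.Nat using (ℕ; zero; suc; _+_; _*_; _∸_; _≤_; _<_; z≤n; s≤s)
open import Data.Nat.Properties using (≤-refl; ≤-reflexive; ≤-trans; <-≤-trans; <-irrefl; +-mono-≤; suc-injective)
open import Data.Nat.Tactic.RingSolver using (solve-∀)
open import Data.Bool using (Bool; true; false)
import Data.Bool.Properties as Bool
open import Data.Fin using (Fin; zero; suc; _↑ˡ_; _↑ʳ_; splitAt)
open import Data.Fin.Properties using (↑ˡ-injective; ↑ʳ-injective; splitAt-↑ˡ; splitAt-↑ʳ)
  renaming (suc-injective to Fin-suc-injective)
open import Data.Fin.Subset using (Subset; ⊥; ⊤; ⁅_⁆; inside; outside; _∈_; _∉_; _⊆_; ∣_∣; ∁)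
open import Data.Fin.Subset.Properties
  using (x∈⁅x⁆; x∈⁅y⁆⇒x≡y; ∣⊥∣≡0; ∣⊤∣≡n; ∣⁅x⁆∣≡1; ∉⊥; ∈⊤; ⊥⊆; ⊆⊤; ⊆-reflexive; ⊆-antisym;
         ∣p∣≤n; p⊆q⇒∣p∣≤∣q∣; _⊆?_; drop-∷-⊆; nonempty?; Empty-unique; x∈∁p⇒x∉p; x∉∁p⇒x∈p)
open import Data.Vec using ([]; _∷_; _++_; replicate; here; there)
open import Data.Vec.Properties
  using (≡-dec; ++-injective; ++-injectiveˡ; lookup-++ˡ; lookup-++ʳ; []=⇒lookup; lookup⇒[]=)
open import Data.List using (List; []; _∷_; map; length; allFin; cartesianProductWith)
open import Data.List.Properties using (length-map; length-++; length-tabulate)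
open import Data.List.Membership.Propositional renaming (_∈_ to _∈ₗ_; _∉_ to _∉ₗ_)
open import Data.List.Membership.Propositional.Properties
  using (∈-map⁺; ∈-map⁻; ∈-allFin; ∈-cartesianProductWith⁺; ∈-cartesianProductWith⁻)
open import Data.List.Relation.Unary.All as All using (All; []; _∷_)
import Data.List.Relation.Unary.Any as Any
open import Data.List.Relation.Unary.AllPairs using (_∷_)
open import Data.List.Relation.Unary.Unique.Propositional using (Unique)
import Data.List.Relation.Unary.Unique.Propositional.Properties as Unique
open import Data.Product using (Σ; _×_; _,_; ∃; ∃₂; proj₁; proj₂)
open import Data.Sum using (_⊎_; inj₁; inj₂; [_,_]′)
open import Function using (_∘_; const)
open import Function.Bundles using (mk⇔; Equivalence)
open import Function.Definitions using (Injective)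
open import Relation.Nullary using (¬_; yes; no; contradiction)
open import Relation.Nullary.Decidable using (from-yes)
open import Relation.Binary.Definitions using (DecidableEquality)
open import Relation.Binary.PropositionalEquality

private
  variable
    k m n : ℕ

_≟ₛ_ : DecidableEquality (Subset n)
_≟ₛ_ = ≡-dec Bool._≟_

∣p∣≡0⇒p≡⊥ : (p : Subset n) → ∣ p ∣ ≡ 0 → p ≡ ⊥
∣p∣≡0⇒p≡⊥ []            _ = refl
∣p∣≡0⇒p≡⊥ (outside ∷ p) e = cong (outside ∷_) (∣p∣≡0⇒p≡⊥ p e)

∣p∣≡1⇒p≡⁅x⁆ : (p : Subset n) → ∣ p ∣ ≡ 1 → ∃ λ x → p ≡ ⁅ x ⁆
∣p∣≡1⇒p≡⁅x⁆ (inside ∷ p)  e = zero , cong (inside ∷_) (∣p∣≡0⇒p≡⊥ p (suc-injective e))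
∣p∣≡1⇒p≡⁅x⁆ (outside ∷ p) e with ∣p∣≡1⇒p≡⁅x⁆ p e
... | x , refl = suc x , refl

⊆∧≢⇒∣p∣<∣q∣ : {p q : Subset n} → p ⊆ q → p ≢ q → ∣ p ∣ < ∣ q ∣
⊆∧≢⇒∣p∣<∣q∣ {p = []}          {[]}          _   p≢q = contradiction refl p≢q
⊆∧≢⇒∣p∣<∣q∣ {p = inside ∷ p}  {outside ∷ q} p⊆q _   with () ← p⊆q here
⊆∧≢⇒∣p∣<∣q∣ {p = outside ∷ p} {inside ∷ q}  p⊆q _   = s≤s (p⊆q⇒∣p∣≤∣q∣ (drop-∷-⊆ p⊆q))
⊆∧≢⇒∣p∣<∣q∣ {p = inside ∷ p}  {inside ∷ q}  p⊆q p≢q = s≤s (⊆∧≢⇒∣p∣<∣q∣ (drop-∷-⊆ p⊆q) (p≢q ∘ cong (inside ∷_)))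
⊆∧≢⇒∣p∣<∣q∣ {p = outside ∷ p} {outside ∷ q} p⊆q p≢q = ⊆∧≢⇒∣p∣<∣q∣ (drop-∷-⊆ p⊆q) (p≢q ∘ cong (outside ∷_))

p≢⊤⇒∃x∉p : (p : Subset n) → p ≢ ⊤ → ∃ λ x → x ∉ p
p≢⊤⇒∃x∉p p p≢⊤ with nonempty? (∁ p)
... | yes (x , x∈∁p) = x , x∈∁p⇒x∉p x∈∁p
... | no ∁p-empty    = contradiction (⊆-antisym ⊆⊤ (λ {x} _ → x∉∁p⇒x∈p (λ x∈∁p → ∁p-empty (x , x∈∁p)))) p≢⊤

⁅⁆-injective : Injective _≡_ _≡_ (⁅_⁆ {n})
⁅⁆-injective {x = x} {y} e = x∈⁅y⁆⇒x≡y y (subst (x ∈_) e (x∈⁅x⁆ x))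

∣p++q∣≡∣p∣+∣q∣ : (p : Subset k) (q : Subset m) → ∣ p ++ q ∣ ≡ ∣ p ∣ + ∣ q ∣
∣p++q∣≡∣p∣+∣q∣ []            q = refl
∣p++q∣≡∣p∣+∣q∣ (inside ∷ p)  q = cong suc (∣p++q∣≡∣p∣+∣q∣ p q)
∣p++q∣≡∣p∣+∣q∣ (outside ∷ p) q = ∣p++q∣≡∣p∣+∣q∣ p q

++-replicate : ∀ {A : Set} k m (a : A) → replicate k a ++ replicate m a ≡ replicate (k + m) a
++-replicate zero    m a = refl
++-replicate (suc k) m a = cong (a ∷_) (++-replicate k m a)

⁅i↑ˡm⁆≡⁅i⁆++⊥ : (i : Fin k) → ⁅ i ↑ˡ m ⁆ ≡ ⁅ i ⁆ ++ ⊥ {m}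
⁅i↑ˡm⁆≡⁅i⁆++⊥ {suc k} {m} zero = cong (inside ∷_) (sym (++-replicate k m outside))
⁅i↑ˡm⁆≡⁅i⁆++⊥ (suc i) = cong (outside ∷_) (⁅i↑ˡm⁆≡⁅i⁆++⊥ i)

⁅k↑ʳj⁆≡⊥++⁅j⁆ : ∀ k (j : Fin m) → ⁅ k ↑ʳ j ⁆ ≡ ⊥ {k} ++ ⁅ j ⁆
⁅k↑ʳj⁆≡⊥++⁅j⁆ zero    j = refl
⁅k↑ʳj⁆≡⊥++⁅j⁆ (suc k) j = cong (outside ∷_) (⁅k↑ʳj⁆≡⊥++⁅j⁆ k j)

∈-++⁺ˡ : {p : Subset k} (q : Subset m) {i : Fin k} → i ∈ p → i ↑ˡ m ∈ p ++ q
∈-++⁺ˡ {p = p} q {i} i∈p = lookup⇒[]= _ (p ++ q) (trans (lookup-++ˡ p q i) ([]=⇒lookup i∈p))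

∈-++⁺ʳ : (p : Subset k) {q : Subset m} {j : Fin m} → j ∈ q → k ↑ʳ j ∈ p ++ q
∈-++⁺ʳ p {q} {j} j∈q = lookup⇒[]= _ (p ++ q) (trans (lookup-++ʳ p q j) ([]=⇒lookup j∈q))

∈-++⁻ˡ : {p : Subset k} (q : Subset m) {i : Fin k} → i ↑ˡ m ∈ p ++ q → i ∈ p
∈-++⁻ˡ {p = p} q {i} h = lookup⇒[]= i p (trans (sym (lookup-++ˡ p q i)) ([]=⇒lookup h))

∈-++⁻ʳ : (p : Subset k) {q : Subset m} {j : Fin m} → k ↑ʳ j ∈ p ++ q → j ∈ q
∈-++⁻ʳ p {q} {j} h = lookup⇒[]= j q (trans (sym (lookup-++ʳ p q j)) ([]=⇒lookup h))

∈-++⁻ : (p : Subset k) {q : Subset m} {x : Fin (k + m)} → x ∈ p ++ q →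
        (∃ λ i → x ≡ i ↑ˡ m × i ∈ p) ⊎ (∃ λ j → x ≡ k ↑ʳ j × j ∈ q)
∈-++⁻ []      x∈q        = inj₂ (_ , refl , x∈q)
∈-++⁻ (_ ∷ p) here       = inj₁ (zero , refl , here)
∈-++⁻ (_ ∷ p) (there x∈) with ∈-++⁻ p x∈
... | inj₁ (i , refl , i∈p) = inj₁ (suc i , refl , there i∈p)
... | inj₂ (j , refl , j∈q) = inj₂ (j , refl , j∈q)

↑ˡ≢↑ʳ : (i : Fin k) (j : Fin m) → i ↑ˡ m ≢ k ↑ʳ j
↑ˡ≢↑ʳ {k} {m} i j eq with () ← trans (sym (splitAt-↑ˡ k i m)) (trans (cong (splitAt k) eq) (splitAt-↑ʳ k m j))

pattern ⊥₃  = outside ∷ outside ∷ outside ∷ []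
pattern A₀  = inside  ∷ outside ∷ outside ∷ []
pattern A₁  = outside ∷ inside  ∷ outside ∷ []
pattern A₂  = outside ∷ outside ∷ inside  ∷ []
pattern C₀₁ = inside  ∷ inside  ∷ outside ∷ []
pattern C₁₂ = outside ∷ inside  ∷ inside  ∷ []
pattern C₀₂ = inside  ∷ outside ∷ inside  ∷ []
pattern ⊤₃  = inside  ∷ inside  ∷ inside  ∷ []

Rainbow : (Fin n → Bool) → Subset n → Set
Rainbow χ X = ∀ {x y} → x ∈ X → y ∈ X → χ x ≡ χ y → x ≡ y

Bool-pigeonhole : (u v w : Bool) → u ≡ v ⊎ v ≡ w ⊎ u ≡ w
Bool-pigeonhole true  true  _     = inj₁ refl
Bool-pigeonhole false false _     = inj₁ refl
Bool-pigeonhole true  false false = inj₂ (inj₁ refl)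
Bool-pigeonhole false true  true  = inj₂ (inj₁ refl)
Bool-pigeonhole true  false true  = inj₂ (inj₂ refl)
Bool-pigeonhole false true  false = inj₂ (inj₂ refl)

r<s<t≤2⇒s≡1 : ∀ {r s t} → r < s → s < t → t ≤ 2 → s ≡ 1
r<s<t≤2⇒s≡1 (s≤s z≤n) (s≤s (s≤s z≤n)) _ = refl
r<s<t≤2⇒s≡1 {s = suc (suc _)} _ (s≤s (s≤s (s≤s _))) (s≤s (s≤s ()))

no-B₃-copy : {F : Family n} (χ : Fin n → Bool) →
             (∀ {X} → X ∈ₗ F → ∣ X ∣ < n → ∣ X ∣ ≤ 2 × Rainbow χ X) → ¬ CopyOfB₃ F
no-B₃-copy {n} χ small (φ , φ∈F , φ-injective , φ-iff) =
  [ collide (from-yes (A₀ ⊆? C₀₁)) (from-yes (A₁ ⊆? C₀₁)) (λ ()) (λ ()) (proj₂ atom₀) (proj₂ atom₁)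
  , [ collide (from-yes (A₁ ⊆? C₁₂)) (from-yes (A₂ ⊆? C₁₂)) (λ ()) (λ ()) (proj₂ atom₁) (proj₂ atom₂)
    , collide (from-yes (A₀ ⊆? C₀₂)) (from-yes (A₂ ⊆? C₀₂)) (λ ()) (λ ()) (proj₂ atom₀) (proj₂ atom₂) ]′ ]′
  (Bool-pigeonhole (χ (proj₁ atom₀)) (χ (proj₁ atom₁)) (χ (proj₁ atom₂)))
  where
    mono : ∀ {p q} → p ⊆ q → φ p ⊆ φ q
    mono = Equivalence.to (φ-iff _ _)

    grow : ∀ {p q} → p ⊆ q → p ≢ q → ∣ φ p ∣ < ∣ φ q ∣
    grow p⊆q p≢q = ⊆∧≢⇒∣p∣<∣q∣ (mono p⊆q) (p≢q ∘ φ-injective)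

    small-below-⊤ : ∀ {p} → p ≢ ⊤₃ → ∣ φ p ∣ ≤ 2 × Rainbow χ (φ p)
    small-below-⊤ {p} p≢⊤ = small (φ∈F p) (<-≤-trans (grow ⊆⊤ p≢⊤) (∣p∣≤n (φ ⊤₃)))

    singleton : ∀ {A C} → A ⊆ C → A ≢ ⊥₃ → A ≢ C → C ≢ ⊤₃ → ∃ λ x → φ A ≡ ⁅ x ⁆
    singleton {A} A⊆C A≢⊥ A≢C C≢⊤ = ∣p∣≡1⇒p≡⁅x⁆ (φ A)
      (r<s<t≤2⇒s≡1 (grow ⊥⊆ (A≢⊥ ∘ sym)) (grow A⊆C A≢C) (proj₁ (small-below-⊤ C≢⊤)))

    collide : ∀ {A A' C x x'} → A ⊆ C → A' ⊆ C → A ≢ A' → C ≢ ⊤₃ →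
              φ A ≡ ⁅ x ⁆ → φ A' ≡ ⁅ x' ⁆ → χ x ≢ χ x'
    collide {x = x} {x'} A⊆C A'⊆C A≢A' C≢⊤ φA φA' χx≡χx' =
      A≢A' (φ-injective (trans φA (trans (cong ⁅_⁆ x≡x') (sym φA'))))
      where
        x≡x' : x ≡ x'
        x≡x' = proj₂ (small-below-⊤ C≢⊤) (mono A⊆C (subst (x ∈_) (sym φA) (x∈⁅x⁆ x)))
                                        (mono A'⊆C (subst (x' ∈_) (sym φA') (x∈⁅x⁆ x'))) χx≡χx'

    atom₀ : ∃ λ x → φ A₀ ≡ ⁅ x ⁆
    atom₀ = singleton (from-yes (A₀ ⊆? C₀₁)) (λ ()) (λ ()) (λ ())
    atom₁ : ∃ λ x → φ A₁ ≡ ⁅ x ⁆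
    atom₁ = singleton (from-yes (A₁ ⊆? C₁₂)) (λ ()) (λ ()) (λ ())
    atom₂ : ∃ λ x → φ A₂ ≡ ⁅ x ⁆
    atom₂ = singleton (from-yes (A₂ ⊆? C₀₂)) (λ ()) (λ ()) (λ ())

record IsPair (P : Subset n) (x y : Fin n) : Set where
  field
    left  : x ∈ P
    right : y ∈ P
    only  : ∀ {z} → z ∈ P → z ≡ x ⊎ z ≡ y

IsPair-sym : {P : Subset n} {x y : Fin n} → IsPair P x y → IsPair P y x
IsPair-sym P≐xy = record { left = right ; right = left ; only = [ inj₂ , inj₁ ]′ ∘ only }
  where open IsPair P≐xy

-- G plays the coatom {0, 2}: it may contain more than a and c, only b ∉ G matters.
module B₃Copy {G P Q : Subset n} {a b c : Fin n} (a≢b : a ≢ b) (b≢c : b ≢ c) (a≢c : a ≢ c)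
  (P≐ab : IsPair P a b) (Q≐bc : IsPair Q b c) (a∈G : a ∈ G) (c∈G : c ∈ G) (b∉G : b ∉ G) where

  private
    module P = IsPair P≐ab
    module Q = IsPair Q≐bc

    pick : Fin 3 → Fin n
    pick zero             = a
    pick (suc zero)       = b
    pick (suc (suc zero)) = c

    pick-injective : Injective _≡_ _≡_ pick
    pick-injective {zero}             {zero}             _  = refl
    pick-injective {suc zero}         {suc zero}         _  = refl
    pick-injective {suc (suc zero)}   {suc (suc zero)}   _  = refl
    pick-injective {zero}             {suc zero}         eq = contradiction eq a≢b
    pick-injective {zero}             {suc (suc zero)}   eq = contradiction eq a≢c
    pick-injective {suc zero}         {suc (suc zero)}   eq = contradiction eq b≢c
    pick-injective {suc zero}         {zero}             eq = contradiction (sym eq) a≢b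
    pick-injective {suc (suc zero)}   {zero}             eq = contradiction (sym eq) a≢c
    pick-injective {suc (suc zero)}   {suc zero}         eq = contradiction (sym eq) b≢c

    embed : Subset 3 → Subset n
    embed ⊥₃  = ⊥
    embed A₀  = ⁅ a ⁆
    embed A₁  = ⁅ b ⁆
    embed A₂  = ⁅ c ⁆
    embed C₀₁ = P
    embed C₁₂ = Q
    embed C₀₂ = G
    embed ⊤₃  = ⊤

    pick-∈ : ∀ p {i} → i ∈ p → pick i ∈ embed p
    pick-∈ ⊤₃  _                    = ∈⊤
    pick-∈ A₀  here                 = x∈⁅x⁆ a
    pick-∈ A₁  (there here)         = x∈⁅x⁆ b
    pick-∈ A₂  (there (there here)) = x∈⁅x⁆ c
    pick-∈ C₀₁ here                 = P.left
    pick-∈ C₀₁ (there here)         = P.right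
    pick-∈ C₁₂ (there here)         = Q.left
    pick-∈ C₁₂ (there (there here)) = Q.right
    pick-∈ C₀₂ here                 = a∈G
    pick-∈ C₀₂ (there (there here)) = c∈G
    pick-∈ A₀  (there (there (there ())))
    pick-∈ A₁  (there (there (there ())))
    pick-∈ C₀₁ (there (there (there ())))

    embed-⊆-image : ∀ p → p ≢ ⊤₃ → p ≢ C₀₂ → ∀ {x} → x ∈ embed p → ∃ λ i → x ≡ pick i × i ∈ p
    embed-⊆-image ⊤₃  p≢⊤ _ _  = contradiction refl p≢⊤
    embed-⊆-image C₀₂ _ p≢G _  = contradiction refl p≢G
    embed-⊆-image ⊥₃  _ _ x∈⊥  = contradiction x∈⊥ ∉⊥
    embed-⊆-image A₀  _ _ x∈   = zero , x∈⁅y⁆⇒x≡y a x∈ , here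
    embed-⊆-image A₁  _ _ x∈   = suc zero , x∈⁅y⁆⇒x≡y b x∈ , there here
    embed-⊆-image A₂  _ _ x∈   = suc (suc zero) , x∈⁅y⁆⇒x≡y c x∈ , there (there here)
    embed-⊆-image C₀₁ _ _ x∈ with P.only x∈
    ... | inj₁ x≡a = zero , x≡a , here
    ... | inj₂ x≡b = suc zero , x≡b , there here
    embed-⊆-image C₁₂ _ _ x∈ with Q.only x∈
    ... | inj₁ x≡b = suc zero , x≡b , there here
    ... | inj₂ x≡c = suc (suc zero) , x≡c , there (there here)

    pick-∈⁻-C₀₂ : ∀ i → pick i ∈ G → i ∈ C₀₂
    pick-∈⁻-C₀₂ zero             _   = here
    pick-∈⁻-C₀₂ (suc zero)       b∈G = contradiction b∈G b∉G
    pick-∈⁻-C₀₂ (suc (suc zero)) _   = there (there here)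

    pick-∈⁻ : ∀ p → p ≢ ⊤₃ → ∀ i → pick i ∈ embed p → i ∈ p
    pick-∈⁻ p p≢⊤ i i∈ with p ≟ₛ C₀₂
    ... | yes refl = pick-∈⁻-C₀₂ i i∈
    ... | no p≢G with embed-⊆-image p p≢⊤ p≢G i∈
    ...   | j , eq , j∈p = subst (_∈ p) (sym (pick-injective eq)) j∈p

    C₀₂-maximal : ∀ q → q ≢ ⊤₃ → C₀₂ ⊆ q → q ≡ C₀₂
    C₀₂-maximal (_ ∷ inside ∷ _ ∷ []) q≢⊤ G⊆q
      with here ← G⊆q here | there (there here) ← G⊆q (there (there here)) = contradiction refl q≢⊤
    C₀₂-maximal (_ ∷ outside ∷ _ ∷ []) q≢⊤ G⊆q
      with here ← G⊆q here | there (there here) ← G⊆q (there (there here)) = refl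

    embed-reflects : ∀ p q → embed p ⊆ embed q → p ⊆ q
    embed-reflects p q φp⊆φq {i} i∈p with q ≟ₛ ⊤₃
    ... | yes refl = ∈⊤
    ... | no q≢⊤   = pick-∈⁻ q q≢⊤ i (φp⊆φq (pick-∈ p i∈p))

    embed-mono : ∀ p q → p ⊆ q → embed p ⊆ embed q
    embed-mono p q p⊆q {x} x∈ with q ≟ₛ ⊤₃ | p ≟ₛ ⊤₃ | p ≟ₛ C₀₂
    ... | yes refl | _        | _        = ∈⊤
    ... | no q≢⊤   | yes refl | _        = contradiction (⊆-antisym ⊆⊤ p⊆q) q≢⊤
    ... | no q≢⊤   | no _     | yes refl with refl ← C₀₂-maximal q q≢⊤ p⊆q = x∈
    ... | no _     | no p≢⊤   | no p≢C₀₂ with i , refl , i∈p ← embed-⊆-image p p≢⊤ p≢C₀₂ x∈ = pick-∈ q (p⊆q i∈p)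

  B₃-copy : (F : Family n) → All (_∈ₗ F) (⊥ ∷ ⊤ ∷ ⁅ a ⁆ ∷ ⁅ b ⁆ ∷ ⁅ c ⁆ ∷ P ∷ Q ∷ []) → CopyOfB₃ (G ∷ F)
  B₃-copy F (⊥∈ ∷ ⊤∈ ∷ a∈ ∷ b∈ ∷ c∈ ∷ P∈ ∷ Q∈ ∷ []) =
    embed , embed-∈ , embed-injective , λ p q → mk⇔ (embed-mono p q) (embed-reflects p q)
    where
      embed-∈ : ∀ p → embed p ∈ₗ G ∷ F
      embed-∈ ⊥₃  = Any.there ⊥∈
      embed-∈ A₀  = Any.there a∈
      embed-∈ A₁  = Any.there b∈
      embed-∈ A₂  = Any.there c∈
      embed-∈ C₀₁ = Any.there P∈
      embed-∈ C₁₂ = Any.there Q∈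
      embed-∈ C₀₂ = Any.here refl
      embed-∈ ⊤₃  = Any.there ⊤∈

      embed-injective : Injective _≡_ _≡_ embed
      embed-injective {p} {q} eq =
        ⊆-antisym (embed-reflects p q (⊆-reflexive eq)) (embed-reflects q p (⊆-reflexive (sym eq)))

open B₃Copy using (B₃-copy)

atMostOne : ∀ k → List (Subset k)
atMostOne k = ⊥ ∷ map ⁅_⁆ (allFin k)

⁅x⁆∈atMostOne : (x : Fin k) → ⁅ x ⁆ ∈ₗ atMostOne k
⁅x⁆∈atMostOne x = Any.there (∈-map⁺ ⁅_⁆ (∈-allFin x))

atMostOne⁻ : {X : Subset k} → X ∈ₗ atMostOne k → X ≡ ⊥ ⊎ ∃ λ x → X ≡ ⁅ x ⁆
atMostOne⁻ (Any.here X≡⊥) = inj₁ X≡⊥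
atMostOne⁻ (Any.there X∈) with x , _ , X≡⁅x⁆ ← ∈-map⁻ ⁅_⁆ X∈ = inj₂ (x , X≡⁅x⁆)

atMostOne-subsingleton : {X : Subset k} → X ∈ₗ atMostOne k → ∀ {x y} → x ∈ X → y ∈ X → x ≡ y
atMostOne-subsingleton X∈ x∈X y∈X with atMostOne⁻ X∈
... | inj₁ refl       = contradiction x∈X ∉⊥
... | inj₂ (z , refl) = trans (x∈⁅y⁆⇒x≡y z x∈X) (sym (x∈⁅y⁆⇒x≡y z y∈X))

atMostOne-∣X∣≤1 : {X : Subset k} → X ∈ₗ atMostOne k → ∣ X ∣ ≤ 1
atMostOne-∣X∣≤1 {k} X∈ with atMostOne⁻ X∈
... | inj₁ refl       = subst (_≤ 1) (sym (∣⊥∣≡0 k)) z≤n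
... | inj₂ (x , refl) = ≤-reflexive (∣⁅x⁆∣≡1 x)

atMostOne-unique : Unique (atMostOne k)
atMostOne-unique {k} = All.tabulate ⊥≢⁅x⁆ ∷ Unique.map⁺ ⁅⁆-injective (Unique.allFin⁺ k)
  where
    ⊥≢⁅x⁆ : ∀ {X} → X ∈ₗ map ⁅_⁆ (allFin k) → ⊥ ≢ X
    ⊥≢⁅x⁆ X∈ refl with x , _ , ⊥≡⁅x⁆ ← ∈-map⁻ ⁅_⁆ X∈ = ∉⊥ (subst (x ∈_) (sym ⊥≡⁅x⁆) (x∈⁅x⁆ x))

length-atMostOne : ∀ k → length (atMostOne k) ≡ suc k
length-atMostOne k = cong suc (trans (length-map ⁅_⁆ (allFin k)) (length-tabulate {n = k} (λ x → x)))

atMostOne⊎two : (X : Subset k) → X ∈ₗ atMostOne k ⊎ ∃₂ λ x y → x ≢ y × x ∈ X × y ∈ X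
atMostOne⊎two [] = inj₁ (Any.here refl)
atMostOne⊎two (outside ∷ X) with atMostOne⊎two X
... | inj₂ (x , y , x≢y , x∈X , y∈X) = inj₂ (suc x , suc y , x≢y ∘ Fin-suc-injective , there x∈X , there y∈X)
... | inj₁ X∈ with atMostOne⁻ X∈
...   | inj₁ refl       = inj₁ (Any.here refl)
...   | inj₂ (x , refl) = inj₁ (⁅x⁆∈atMostOne (suc x))
atMostOne⊎two (inside ∷ X) with nonempty? X
... | yes (x , x∈X) = inj₂ (zero , suc x , (λ ()) , here , there x∈X)
... | no X-empty with refl ← Empty-unique X-empty = inj₁ (⁅x⁆∈atMostOne zero)

⊤∉atMostOne : 2 ≤ k → ⊤ ∉ₗ atMostOne k
⊤∉atMostOne {k} 2≤k ⊤∈ with s≤s () ← ≤-trans 2≤k (subst (_≤ 1) (∣⊤∣≡n k) (atMostOne-∣X∣≤1 ⊤∈))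

partialTransversals : ∀ k m → Family (k + m)
partialTransversals k m = cartesianProductWith _++_ (atMostOne k) (atMostOne m)

transversalFamily : ∀ k m → Family (k + m)
transversalFamily k m = ⊤ ∷ partialTransversals k m

length-cartesianProductWith : {A B C : Set} (f : A → B → C) (xs : List A) (ys : List B) →
                              length (cartesianProductWith f xs ys) ≡ length xs * length ys
length-cartesianProductWith f []       ys = refl
length-cartesianProductWith f (x ∷ xs) ys = begin
  length (cartesianProductWith f (x ∷ xs) ys)                    ≡⟨ length-++ (map (f x) ys) ⟩
  length (map (f x) ys) + length (cartesianProductWith f xs ys)  ≡⟨ cong₂ _+_ (length-map (f x) ys)
                                                                             (length-cartesianProductWith f xs ys) ⟩
  length ys + length xs * length ys                              ∎
  where open ≡-Reasoning

module _ (k m : ℕ) where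

  ∈-transversalFamily : {h : Subset k} {t : Subset m} →
                        h ∈ₗ atMostOne k → t ∈ₗ atMostOne m → h ++ t ∈ₗ transversalFamily k m
  ∈-transversalFamily h∈ t∈ = Any.there (∈-cartesianProductWith⁺ _++_ h∈ t∈)

  length-transversalFamily : length (transversalFamily k m) ≡ suc (suc k * suc m)
  length-transversalFamily = cong suc (begin
    length (partialTransversals k m)             ≡⟨ length-cartesianProductWith _++_ (atMostOne k) (atMostOne m) ⟩
    length (atMostOne k) * length (atMostOne m)  ≡⟨ cong₂ _*_ (length-atMostOne k) (length-atMostOne m) ⟩
    suc k * suc m                                ∎)
    where open ≡-Reasoning

  transversalFamily-unique : 2 ≤ k → Unique (transversalFamily k m)
  transversalFamily-unique 2≤k = All.tabulate ⊤≢ ∷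
    Unique.cartesianProductWith⁺ _++_ (λ {w} {x} → ++-injective w x) (atMostOne-unique {k}) (atMostOne-unique {m})
    where
      ⊤≢ : ∀ {X} → X ∈ₗ partialTransversals k m → ⊤ ≢ X
      ⊤≢ X∈ ⊤≡X with h , t , h∈ , _ , refl ← ∈-cartesianProductWith⁻ _++_ (atMostOne k) (atMostOne m) X∈ =
        ⊤∉atMostOne 2≤k (subst (_∈ₗ atMostOne k) (sym ⊤≡h) h∈)
        where
          ⊤≡h : ⊤ ≡ h
          ⊤≡h = ++-injectiveˡ ⊤ h (trans (++-replicate k m inside) ⊤≡X)

  side : Fin (k + m) → Bool
  side x = [ const true , const false ]′ (splitAt k x)

  side-↑ˡ≢side-↑ʳ : (i : Fin k) (j : Fin m) → side (i ↑ˡ m) ≢ side (k ↑ʳ j)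
  side-↑ˡ≢side-↑ʳ i j rewrite splitAt-↑ˡ k i m | splitAt-↑ʳ k m j = λ ()

  partialTransversal-small : {X : Subset (k + m)} → X ∈ₗ partialTransversals k m → ∣ X ∣ ≤ 2 × Rainbow side X
  partialTransversal-small X∈
    with h , t , h∈ , t∈ , refl ← ∈-cartesianProductWith⁻ _++_ (atMostOne k) (atMostOne m) X∈ =
    subst (_≤ 2) (sym (∣p++q∣≡∣p∣+∣q∣ h t)) (+-mono-≤ (atMostOne-∣X∣≤1 h∈) (atMostOne-∣X∣≤1 t∈)) , rainbow
    where
      rainbow : Rainbow side (h ++ t)
      rainbow x∈ y∈ same-side with ∈-++⁻ h x∈ | ∈-++⁻ h y∈
      ... | inj₁ (i , refl , i∈h) | inj₁ (i' , refl , i'∈h) = cong (_↑ˡ m) (atMostOne-subsingleton h∈ i∈h i'∈h)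
      ... | inj₂ (j , refl , j∈t) | inj₂ (j' , refl , j'∈t) = cong (k ↑ʳ_) (atMostOne-subsingleton t∈ j∈t j'∈t)
      ... | inj₁ (i , refl , _)   | inj₂ (j , refl , _)     = contradiction same-side (side-↑ˡ≢side-↑ʳ i j)
      ... | inj₂ (j , refl , _)   | inj₁ (i , refl , _)     = contradiction (sym same-side) (side-↑ˡ≢side-↑ʳ i j)

  transversalFamily-B₃-free : ¬ CopyOfB₃ (transversalFamily k m)
  transversalFamily-B₃-free = no-B₃-copy side small
    where
      small : ∀ {X} → X ∈ₗ transversalFamily k m → ∣ X ∣ < k + m → ∣ X ∣ ≤ 2 × Rainbow side X
      small (Any.here refl) ∣⊤∣<k+m = contradiction (subst (_< k + m) (∣⊤∣≡n (k + m)) ∣⊤∣<k+m) (<-irrefl refl)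
      small (Any.there X∈)  _       = partialTransversal-small X∈

  ⊥∈transversalFamily : ⊥ ∈ₗ transversalFamily k m
  ⊥∈transversalFamily = subst (_∈ₗ transversalFamily k m) (++-replicate k m outside)
                          (∈-transversalFamily (Any.here refl) (Any.here refl))

  ⁅i↑ˡm⁆∈transversalFamily : (i : Fin k) → ⁅ i ↑ˡ m ⁆ ∈ₗ transversalFamily k m
  ⁅i↑ˡm⁆∈transversalFamily i = subst (_∈ₗ transversalFamily k m) (sym (⁅i↑ˡm⁆≡⁅i⁆++⊥ i))
                                 (∈-transversalFamily (⁅x⁆∈atMostOne i) (Any.here refl))

  ⁅k↑ʳj⁆∈transversalFamily : (j : Fin m) → ⁅ k ↑ʳ j ⁆ ∈ₗ transversalFamily k m
  ⁅k↑ʳj⁆∈transversalFamily j = subst (_∈ₗ transversalFamily k m) (sym (⁅k↑ʳj⁆≡⊥++⁅j⁆ k j))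
                                 (∈-transversalFamily (Any.here refl) (⁅x⁆∈atMostOne j))

  ⁅i⁆++⁅j⁆∈transversalFamily : (i : Fin k) (j : Fin m) → ⁅ i ⁆ ++ ⁅ j ⁆ ∈ₗ transversalFamily k m
  ⁅i⁆++⁅j⁆∈transversalFamily i j = ∈-transversalFamily (⁅x⁆∈atMostOne i) (⁅x⁆∈atMostOne j)

  ⁅i⁆++⁅j⁆-pair : (i : Fin k) (j : Fin m) → IsPair (⁅ i ⁆ ++ ⁅ j ⁆) (i ↑ˡ m) (k ↑ʳ j)
  ⁅i⁆++⁅j⁆-pair i j = record
    { left  = ∈-++⁺ˡ ⁅ j ⁆ (x∈⁅x⁆ i)
    ; right = ∈-++⁺ʳ ⁅ i ⁆ (x∈⁅x⁆ j)
    ; only  = only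
    }
    where
      only : ∀ {z} → z ∈ ⁅ i ⁆ ++ ⁅ j ⁆ → z ≡ i ↑ˡ m ⊎ z ≡ k ↑ʳ j
      only z∈ with ∈-++⁻ ⁅ i ⁆ z∈
      ... | inj₁ (i' , refl , i'∈) = inj₁ (cong (_↑ˡ m) (x∈⁅y⁆⇒x≡y i i'∈))
      ... | inj₂ (j' , refl , j'∈) = inj₂ (cong (k ↑ʳ_) (x∈⁅y⁆⇒x≡y j j'∈))

  copy-across-head : {h : Subset k} {t : Subset m} {i i' : Fin k} {j : Fin m} →
                     i ≢ i' → i ∈ h → i' ∈ h → j ∉ t → CopyOfB₃ ((h ++ t) ∷ transversalFamily k m)
  copy-across-head {h} {t} {i} {i'} {j} i≢i' i∈h i'∈h j∉t =
    B₃-copy (↑ˡ≢↑ʳ i j) (↑ˡ≢↑ʳ i' j ∘ sym) (i≢i' ∘ ↑ˡ-injective m i i')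
            (⁅i⁆++⁅j⁆-pair i j) (IsPair-sym (⁅i⁆++⁅j⁆-pair i' j))
            (∈-++⁺ˡ t i∈h) (∈-++⁺ˡ t i'∈h) (j∉t ∘ ∈-++⁻ʳ h)
            (transversalFamily k m)
            (⊥∈transversalFamily ∷ Any.here refl ∷
             ⁅i↑ˡm⁆∈transversalFamily i ∷ ⁅k↑ʳj⁆∈transversalFamily j ∷ ⁅i↑ˡm⁆∈transversalFamily i' ∷
             ⁅i⁆++⁅j⁆∈transversalFamily i j ∷ ⁅i⁆++⁅j⁆∈transversalFamily i' j ∷ [])

  copy-across-tail : {h : Subset k} {t : Subset m} {i : Fin k} {j j' : Fin m} →
                     j ≢ j' → j ∈ t → j' ∈ t → i ∉ h → CopyOfB₃ ((h ++ t) ∷ transversalFamily k m)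
  copy-across-tail {h} {t} {i} {j} {j'} j≢j' j∈t j'∈t i∉h =
    B₃-copy (↑ˡ≢↑ʳ i j ∘ sym) (↑ˡ≢↑ʳ i j') (j≢j' ∘ ↑ʳ-injective k j j')
            (IsPair-sym (⁅i⁆++⁅j⁆-pair i j)) (⁅i⁆++⁅j⁆-pair i j')
            (∈-++⁺ʳ h j∈t) (∈-++⁺ʳ h j'∈t) (i∉h ∘ ∈-++⁻ˡ t)
            (transversalFamily k m)
            (⊥∈transversalFamily ∷ Any.here refl ∷
             ⁅k↑ʳj⁆∈transversalFamily j ∷ ⁅i↑ˡm⁆∈transversalFamily i ∷ ⁅k↑ʳj⁆∈transversalFamily j' ∷
             ⁅i⁆++⁅j⁆∈transversalFamily i j ∷ ⁅i⁆++⁅j⁆∈transversalFamily i j' ∷ [])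

  saturated-by-tail : {h : Subset k} (t : Subset m) → h ∈ₗ atMostOne k → (i : Fin k) → i ∉ h →
                      h ++ t ∉ₗ transversalFamily k m → CopyOfB₃ ((h ++ t) ∷ transversalFamily k m)
  saturated-by-tail t h∈ i i∉h G∉F with atMostOne⊎two t
  ... | inj₁ t∈                            = contradiction (∈-transversalFamily h∈ t∈) G∉F
  ... | inj₂ (j , j' , j≢j' , j∈t , j'∈t) = copy-across-tail j≢j' j∈t j'∈t i∉h

transversalFamily-saturated : (G : Subset (2 + m)) → G ∉ₗ transversalFamily 2 m →
                              CopyOfB₃ (G ∷ transversalFamily 2 m)
transversalFamily-saturated {m} (inside ∷ inside ∷ t) G∉F
  with j , j∉t ← p≢⊤⇒∃x∉p t (G∉F ∘ Any.here ∘ cong (λ s → inside ∷ inside ∷ s)) =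
  copy-across-head 2 m {i = zero} {suc zero} (λ ()) here (there here) j∉t
transversalFamily-saturated {m} (outside ∷ outside ∷ t) =
  saturated-by-tail 2 m t (Any.here refl) zero (λ ())
transversalFamily-saturated {m} (outside ∷ inside ∷ t) =
  saturated-by-tail 2 m t (⁅x⁆∈atMostOne (suc zero)) zero (λ ())
transversalFamily-saturated {m} (inside ∷ outside ∷ t) =
  saturated-by-tail 2 m t (⁅x⁆∈atMostOne zero) (suc zero) (λ { (there ()) })

proposition3p1 : (n : ℕ) → 2 ≤ n →
    Σ (Family n) λ F → Unique F × InducedB₃Saturated F × length F ≤ 3 * n ∸ 2
proposition3p1 (suc (suc m)) (s≤s (s≤s z≤n)) =
  transversalFamily 2 m ,
  transversalFamily-unique 2 m ≤-refl ,
  (transversalFamily-B₃-free 2 m , transversalFamily-saturated) ,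
  ≤-reflexive (trans (length-transversalFamily 2 m) (cong (_∸ 2) (1+3[1+m]≡3n∸2 m)))
  where
    1+3[1+m]≡3n∸2 : ∀ m → 2 + suc (3 * suc m) ≡ 3 * (2 + m)
    1+3[1+m]≡3n∸2 = solve-∀
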